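{- Let $v, w \in S_n$ be fully commutative permutations such that $w = v s_i$ with $\ell(w) = \ell(v) + 1$. Then $\mathrm{Row}_1(P(v)) \supseteq \mathrm{Row}_1(P(w))$; equivalently, $\mathrm{Row}_2(P(v)) \subseteq \mathrm{Row}_2(P(w))$.
   Context: $s_i$ is the simple reflection swapping $i$ and $i+1$, and $\ell$ denotes Coxeter length (number of inversions); $w = vs_i$ means $w$ is obtained from the one-line notation of $v$ by swapping the entries in positions $i$ and $i+1$. A permutation is fully commutative iff it avoids the pattern $321$. $P(w)$ denotes the RSK (row-insertion) insertion tableau of the one-line notation $w(1)\cdots w(n)$; for fully commutative $w$ it has at most two rows. For a tableau $T$, $\mathrm{Row}_1(T)$ and $\mathrm{Row}_2(T)$ denote the sets of entries in its first and second rows. -}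

module Defs where

open import Data.Nat using (ℕ; zero; suc; _+_; _<_; _<?_; _>_)
open import Data.List using (List; []; _∷_; foldl; length; upTo)
open import Data.Maybe using (Maybe; just; nothing)
open import Data.Product using (_×_; _,_; ∃-syntax)
open import Relation.Nullary using (yes; no)
open import Data.List.Relation.Binary.Sublist.Propositional using (_⊆_)
open import Data.List.Relation.Binary.Permutation.Propositional using (_↭_)
open import Relation.Nullary using (¬_)

-- A permutation of S_n is given in one-line notation as a list of the
-- values 0,1,…,n-1 (0-based relabelling of 1..n), each occurring once.
IsPerm : ℕ → List ℕ → Set
IsPerm n w = w ↭ upTo n

-- w s_i : swap the entries in (0-based) positions i and i+1.
swapAt : ℕ → List ℕ → List ℕ
swapAt zero    (a ∷ b ∷ xs) = b ∷ a ∷ xs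
swapAt zero    xs           = xs
swapAt (suc i) []           = []
swapAt (suc i) (a ∷ xs)     = a ∷ swapAt i xs

countLess : ℕ → List ℕ → ℕ
countLess a [] = 0
countLess a (b ∷ xs) with b <? a
... | yes _ = suc (countLess a xs)
... | no  _ = countLess a xs

-- Coxeter length = number of inversions
inv : List ℕ → ℕ
inv [] = 0
inv (a ∷ xs) = countLess a xs + inv xs

Contains321 : List ℕ → Set
Contains321 w = ∃[ a ] ∃[ b ] ∃[ c ] ((c ∷ b ∷ a ∷ []) ⊆ w × c > b × b > a)

FullyCommutative : List ℕ → Set
FullyCommutative w = ¬ Contains321 w

Tableau : Set
Tableau = List (List ℕ)

rowInsert : ℕ → List ℕ → List ℕ × Maybe ℕ
rowInsert x [] = (x ∷ [] , nothing)
rowInsert x (y ∷ ys) with x <? y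
... | yes _ = (x ∷ ys , just y)
... | no  _ with rowInsert x ys
...   | (r , m) = (y ∷ r , m)

insertT : ℕ → Tableau → Tableau
insertT x [] = (x ∷ []) ∷ []
insertT x (r ∷ rs) with rowInsert x r
... | (r' , nothing) = r' ∷ rs
... | (r' , just y)  = r' ∷ insertT y rs

P : List ℕ → Tableau
P w = foldl (λ T x → insertT x T) [] w

Row1 : Tableau → List ℕ
Row1 [] = []
Row1 (r ∷ _) = r

Row2 : Tableau → List ℕ
Row2 [] = []
Row2 (_ ∷ []) = []
Row2 (_ ∷ r ∷ _) = r

-- For a 321-avoiding word only the first two rows of the insertion tableau matter,
-- and the second row only ever grows at its end: whenever y in row 2 lies above a smaller r in
-- row 1, the word read so far has an inversion c … b with b ≥ r, so an entry y bumped by a later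
-- x < y cannot meet a larger entry of row 2 without creating a 321. For v = … a b … and
-- w = … b a … with a < b, every letter before the pair is ≤ b (else it forms 321 with b a in w),
-- so after the pair the two tableaux agree except that row 1 of v may keep one entry that w has
-- bumped into row 2. As rows are sorted and row 2 only appends, every later insertion preserves
-- this relation, and it gives both inclusions.
module Submission where

open import Defs
open import Data.Nat using (ℕ; zero; suc; _+_; _<_; _≤_; _<?_)
open import Data.Nat.Properties
  using ( ≮⇒≥; <⇒≤; <⇒≱; ≤⇒≯; ≤-refl; ≤-reflexive; ≤-trans; <-≤-trans; n≤1+n
        ; +-monoˡ-≤; +-cancelˡ-≡; +-suc; +-commutativeSemigroup; module ≤-Reasoning)
open import Data.List using (List; []; _∷_; _++_; _∷ʳ_; foldl)
open import Data.List.Properties using (++-assoc; ++-identityʳ; foldl-++)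
open import Data.List.Membership.Propositional using (_∈_)
open import Data.List.Membership.Propositional.Properties using (∈-++⁺ˡ; ∈-++⁺ʳ; ∈-++⁻)
open import Data.List.Relation.Unary.Any using (here; there)
open import Data.List.Relation.Unary.All as All using (All; []; _∷_)
import Data.List.Relation.Unary.All.Properties as All
open import Data.List.Relation.Unary.AllPairs using (AllPairs; []; _∷_)
open import Data.List.Relation.Binary.Sublist.Propositional using (_⊆_; []; _∷_; from∈; minimum)
open import Data.List.Relation.Binary.Sublist.Propositional.Properties using (++⁺; ++⁺ʳ)
open import Data.List.Relation.Binary.Subset.Propositional using () renaming (_⊆_ to _⊆ₘ_)
import Data.List.Relation.Binary.Subset.Propositional.Properties as Subset
open Subset using (All-resp-⊇)
import Data.List.Relation.Unary.AllPairs.Properties as AllPairs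
open import Data.Maybe using (Maybe; just; nothing)
open import Data.Product using (_×_; _,_; proj₁; proj₂; ∃-syntax)
open import Data.Sum using (inj₁; inj₂)
open import Data.Unit using (⊤; tt)
open import Algebra.Properties.CommutativeSemigroup +-commutativeSemigroup using (x∙yz≈y∙xz)
open import Relation.Nullary.Decidable using (decidable-stable)
open import Relation.Nullary using (¬_; yes; no; contradiction)
open import Relation.Binary.PropositionalEquality
  using (_≡_; refl; sym; trans; cong; subst; subst₂; module ≡-Reasoning)

All-replace : ∀ {P : ℕ → Set} {x y} p q → All P (p ++ y ∷ q) → P x → All P (p ++ x ∷ q)
All-replace p q all px = All.++⁺ (All.++⁻ˡ p all) (px ∷ All.tail (All.++⁻ʳ p all))

sorted-after : ∀ {m bs} as → AllPairs _≤_ (as ++ m ∷ bs) → All (m ≤_) bs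
sorted-after []       (m≤bs ∷ _) = m≤bs
sorted-after (_ ∷ as) (_ ∷ s)    = sorted-after as s

sorted-snoc : ∀ {x r} → AllPairs _≤_ r → All (_≤ x) r → AllPairs _≤_ (r ∷ʳ x)
sorted-snoc s r≤x = AllPairs.++⁺ s ([] ∷ []) (All.map (_∷ []) r≤x)

sorted-replace : ∀ {x y} p q → AllPairs _≤_ (p ++ y ∷ q) → All (_≤ x) p → x ≤ y → AllPairs _≤_ (p ++ x ∷ q)
sorted-replace []      q (y≤q ∷ s) []          x≤y = All.map (≤-trans x≤y) y≤q ∷ s
sorted-replace (_ ∷ p) q (z≤ ∷ s)  (z≤x ∷ p≤x) x≤y = All-replace p q z≤ z≤x ∷ sorted-replace p q s p≤x x≤y

∷ʳ-⊆ₘ : ∀ {x : ℕ} {xs ys} → xs ⊆ₘ ys → x ∈ ys → xs ∷ʳ x ⊆ₘ ys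
∷ʳ-⊆ₘ {xs = xs} xs⊆ys x∈ys z∈ with ∈-++⁻ xs z∈
... | inj₁ z∈xs        = xs⊆ys z∈xs
... | inj₂ (here refl) = x∈ys

rowInsert-append : ∀ {x} r → All (_≤ x) r → rowInsert x r ≡ (r ∷ʳ x , nothing)
rowInsert-append [] [] = refl
rowInsert-append {x} (y ∷ r) (y≤x ∷ r≤x) with x <? y
... | yes x<y = contradiction y≤x (<⇒≱ x<y)
... | no _ rewrite rowInsert-append r r≤x = refl

rowInsert-bump : ∀ {x y} p q → All (_≤ x) p → x < y → rowInsert x (p ++ y ∷ q) ≡ (p ++ x ∷ q , just y)
rowInsert-bump {x} {y} [] q [] x<y with x <? y
... | yes _ = refl
... | no x≮y = contradiction x<y x≮y
rowInsert-bump {x} (z ∷ p) q (z≤x ∷ p≤x) x<y with x <? z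
... | yes x<z = contradiction z≤x (<⇒≱ x<z)
... | no _ rewrite rowInsert-bump p q p≤x x<y = refl

data RowInsertion (x : ℕ) : List ℕ → Set where
  appends : ∀ {r} → All (_≤ x) r → RowInsertion x r
  bumps   : ∀ p {y} q → All (_≤ x) p → x < y → RowInsertion x (p ++ y ∷ q)

rowInsertion : ∀ x r → RowInsertion x r
rowInsertion x [] = appends []
rowInsertion x (y ∷ r) with x <? y
... | yes x<y = bumps [] r [] x<y
... | no x≮y with rowInsertion x r
...   | appends r≤x       = appends (≮⇒≥ x≮y ∷ r≤x)
...   | bumps p q p≤x x<z = bumps (y ∷ p) q (≮⇒≥ x≮y ∷ p≤x) x<z

-- The first two rows of an insertion tableau

infix 4.5 _∣_
record Rows : Set where
  constructor _∣_
  field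
    row₁ row₂ : List ℕ
open Rows

insertBumped : Maybe ℕ → List ℕ → List ℕ
insertBumped nothing  r = r
insertBumped (just y) r = proj₁ (rowInsert y r)

insert₂ : ℕ → Rows → Rows
insert₂ x rs = proj₁ (rowInsert x (row₁ rs)) ∣ insertBumped (proj₂ (rowInsert x (row₁ rs))) (row₂ rs)

insertAll : Rows → List ℕ → Rows
insertAll = foldl (λ rs x → insert₂ x rs)

rows : Tableau → Rows
rows T = Row1 T ∣ Row2 T

Row2-∷ : ∀ r T → Row2 (r ∷ T) ≡ Row1 T
Row2-∷ r []      = refl
Row2-∷ r (_ ∷ _) = refl

Row1-insertT : ∀ x T → Row1 (insertT x T) ≡ proj₁ (rowInsert x (Row1 T))
Row1-insertT x []      = refl
Row1-insertT x (r ∷ T) with rowInsert x r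
... | (r′ , nothing) = refl
... | (r′ , just y)  = refl

rows-insertT : ∀ x T → rows (insertT x T) ≡ insert₂ x (rows T)
rows-insertT x []      = refl
rows-insertT x (r ∷ T) with rowInsert x r
... | (r′ , nothing) = cong (r′ ∣_) (trans (Row2-∷ r′ T) (sym (Row2-∷ r T)))
... | (r′ , just y)  = cong (r′ ∣_) (begin
  Row2 (r′ ∷ insertT y T)          ≡⟨ Row2-∷ r′ (insertT y T) ⟩
  Row1 (insertT y T)               ≡⟨ Row1-insertT y T ⟩
  proj₁ (rowInsert y (Row1 T))     ≡⟨ cong (λ r₂ → proj₁ (rowInsert y r₂)) (sym (Row2-∷ r T)) ⟩
  proj₁ (rowInsert y (Row2 (r ∷ T))) ∎)
  where open ≡-Reasoning

rows-foldl-insertT : ∀ T w → rows (foldl (λ T x → insertT x T) T w) ≡ insertAll (rows T) w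
rows-foldl-insertT T []      = refl
rows-foldl-insertT T (x ∷ w) =
  trans (rows-foldl-insertT (insertT x T) w) (cong (λ rs → insertAll rs w) (rows-insertT x T))

rows-P : ∀ w → rows (P w) ≡ insertAll ([] ∣ []) w
rows-P = rows-foldl-insertT []

appendBumped : Maybe ℕ → List ℕ → List ℕ
appendBumped nothing  r = r
appendBumped (just y) r = r ∷ʳ y

BumpFits : Maybe ℕ → List ℕ → Set
BumpFits nothing  _ = ⊤
BumpFits (just y) r = All (_≤ y) r

SecondRowAppends : ℕ → Rows → Set
SecondRowAppends x rs = BumpFits (proj₂ (rowInsert x (row₁ rs))) (row₂ rs)

appendOutcome : List ℕ × Maybe ℕ → List ℕ → Rows
appendOutcome (r , m) r₂ = r ∣ appendBumped m r₂

insertBumped-fits : ∀ m r → BumpFits m r → insertBumped m r ≡ appendBumped m r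
insertBumped-fits nothing  r _   = refl
insertBumped-fits (just y) r r≤y = cong proj₁ (rowInsert-append r r≤y)

insert₂-appending : ∀ x rs → SecondRowAppends x rs → insert₂ x rs ≡ appendOutcome (rowInsert x (row₁ rs)) (row₂ rs)
insert₂-appending x rs fits =
  cong (proj₁ (rowInsert x (row₁ rs)) ∣_) (insertBumped-fits (proj₂ (rowInsert x (row₁ rs))) (row₂ rs) fits)

insert₂-append : ∀ {x r₁ r₂} → All (_≤ x) r₁ → insert₂ x (r₁ ∣ r₂) ≡ (r₁ ∷ʳ x ∣ r₂)
insert₂-append {r₁ = r₁} r₁≤x rewrite rowInsert-append r₁ r₁≤x = refl

insert₂-bump : ∀ {x y r₂} p q → All (_≤ x) p → x < y →
  insert₂ x (p ++ y ∷ q ∣ r₂) ≡ (p ++ x ∷ q ∣ proj₁ (rowInsert y r₂))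
insert₂-bump p q p≤x x<y rewrite rowInsert-bump p q p≤x x<y = refl

-- Rows of a 321-avoiding word

InversionAbove : List ℕ → ℕ → Set
InversionAbove u r = ∃[ c ] ∃[ b ] (c ∷ b ∷ []) ⊆ u × b < c × r ≤ b

InversionAbove-++ : ∀ {u r} t → InversionAbove u r → InversionAbove (u ++ t) r
InversionAbove-++ t (c , b , cb⊆u , b<c , r≤b) = c , b , ++⁺ʳ t cb⊆u , b<c , r≤b

record Invariant (u : List ℕ) (rs : Rows) : Set where
  field
    sorted   : AllPairs _≤_ (row₁ rs)
    row₁⊆u   : row₁ rs ⊆ₘ u
    row₂⊆u   : row₂ rs ⊆ₘ u
    crossing : ∀ {y r} → y ∈ row₂ rs → r ∈ row₁ rs → r < y → InversionAbove u r

invariant-[] : Invariant [] ([] ∣ [])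
invariant-[] = record { sorted = [] ; row₁⊆u = λ () ; row₂⊆u = λ () ; crossing = λ () }

FullyCommutative-prefix : ∀ {u} t → FullyCommutative (u ++ t) → FullyCommutative u
FullyCommutative-prefix t fc (a , b , c , cba⊆u , b<c , a<b) = fc (a , b , c , ++⁺ʳ t cba⊆u , b<c , a<b)

FullyCommutative-∷ʳ : ∀ u x l → FullyCommutative (u ++ x ∷ l) → FullyCommutative (u ∷ʳ x ++ l)
FullyCommutative-∷ʳ u x l = subst FullyCommutative (sym (++-assoc u (x ∷ []) l))

InversionAbove-last : ∀ {u x y r} → y ∈ u → x < y → r ≤ x → InversionAbove (u ∷ʳ x) r
InversionAbove-last y∈u x<y r≤x = _ , _ , ++⁺ (from∈ y∈u) (refl ∷ []) , x<y , r≤x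

row₂-below-bumped : ∀ {u x y rs} → FullyCommutative (u ∷ʳ x) → Invariant u rs →
  y ∈ row₁ rs → x < y → All (_≤ y) (row₂ rs)
row₂-below-bumped {x = x} fc I y∈r₁ x<y = All.tabulate λ z∈r₂ → ≮⇒≥ λ y<z →
  let (c , b , cb⊆u , b<c , y≤b) = Invariant.crossing I z∈r₂ y∈r₁ y<z
  in fc (x , b , c , ++⁺ cb⊆u (refl ∷ []) , b<c , <-≤-trans x<y y≤b)

secondRowAppends : ∀ {u x r₁ r₂} → FullyCommutative (u ∷ʳ x) → Invariant u (r₁ ∣ r₂) → SecondRowAppends x (r₁ ∣ r₂)
secondRowAppends {x = x} {r₁} fc I with rowInsertion x r₁
... | appends r₁≤x rewrite rowInsert-append r₁ r₁≤x = tt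
... | bumps p q p≤x x<y rewrite rowInsert-bump p q p≤x x<y =
  row₂-below-bumped fc I (∈-++⁺ʳ p (here refl)) x<y

invariant-append : ∀ {u x r₁ r₂} → Invariant u (r₁ ∣ r₂) → All (_≤ x) r₁ → Invariant (u ∷ʳ x) (r₁ ∷ʳ x ∣ r₂)
invariant-append {u} {x} {r₁} {r₂} I r₁≤x = record
  { sorted   = sorted-snoc sorted r₁≤x
  ; row₁⊆u   = Subset.++⁺ row₁⊆u Subset.⊆-refl
  ; row₂⊆u   = Subset.⊆-trans row₂⊆u (Subset.xs⊆xs++ys u _)
  ; crossing = cross
  }
  where
  open Invariant I
  cross : ∀ {y r} → y ∈ r₂ → r ∈ r₁ ∷ʳ x → r < y → InversionAbove (u ∷ʳ x) r
  cross y∈r₂ r∈ r<y with ∈-++⁻ r₁ r∈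
  ... | inj₁ r∈r₁        = InversionAbove-++ _ (crossing y∈r₂ r∈r₁ r<y)
  ... | inj₂ (here refl) = InversionAbove-last (row₂⊆u y∈r₂) r<y ≤-refl

invariant-bump : ∀ {u x y r₂} p q → Invariant u (p ++ y ∷ q ∣ r₂) → All (_≤ x) p → x < y →
  Invariant (u ∷ʳ x) (p ++ x ∷ q ∣ r₂ ∷ʳ y)
invariant-bump {u} {x} {y} {r₂} p q I p≤x x<y = record
  { sorted   = sorted-replace p q sorted p≤x (<⇒≤ x<y)
  ; row₁⊆u   = row₁′⊆u
  ; row₂⊆u   = Subset.⊆-trans row₂′⊆u (Subset.xs⊆xs++ys u _)
  ; crossing = cross
  }
  where
  open Invariant I
  y∈r₁ : y ∈ p ++ y ∷ q
  y∈r₁ = ∈-++⁺ʳ p (here refl)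
  row₁′⊆u : p ++ x ∷ q ⊆ₘ u ∷ʳ x
  row₁′⊆u z∈ with ∈-++⁻ p z∈
  ... | inj₁ z∈p         = ∈-++⁺ˡ (row₁⊆u (∈-++⁺ˡ z∈p))
  ... | inj₂ (here refl) = ∈-++⁺ʳ u (here refl)
  ... | inj₂ (there z∈q) = ∈-++⁺ˡ (row₁⊆u (∈-++⁺ʳ p (there z∈q)))
  row₂′⊆u : r₂ ∷ʳ y ⊆ₘ u
  row₂′⊆u = ∷ʳ-⊆ₘ row₂⊆u (row₁⊆u y∈r₁)
  cross : ∀ {y′ r} → y′ ∈ r₂ ∷ʳ y → r ∈ p ++ x ∷ q → r < y′ → InversionAbove (u ∷ʳ x) r
  cross y′∈ r∈ r<y′ with ∈-++⁻ p r∈ | ∈-++⁻ r₂ y′∈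
  ... | inj₂ (here refl)  | _                = InversionAbove-last (row₂′⊆u y′∈) r<y′ ≤-refl
  ... | inj₁ r∈p          | inj₁ y′∈r₂       = InversionAbove-++ _ (crossing y′∈r₂ (∈-++⁺ˡ r∈p) r<y′)
  ... | inj₂ (there r∈q)  | inj₁ y′∈r₂       = InversionAbove-++ _ (crossing y′∈r₂ (∈-++⁺ʳ p (there r∈q)) r<y′)
  ... | inj₁ r∈p          | inj₂ (here refl) = InversionAbove-last (row₁⊆u y∈r₁) x<y (All.lookup p≤x r∈p)
  ... | inj₂ (there r∈q)  | inj₂ (here refl) = contradiction r<y′ (≤⇒≯ (All.lookup (sorted-after p sorted) r∈q))

insert₂-invariant : ∀ {u x rs} → FullyCommutative (u ∷ʳ x) → Invariant u rs → Invariant (u ∷ʳ x) (insert₂ x rs)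
insert₂-invariant {x = x} {r₁ ∣ r₂} fc I with rowInsertion x r₁
... | appends r₁≤x rewrite insert₂-append {r₂ = r₂} r₁≤x = invariant-append I r₁≤x
... | bumps p q p≤x x<y
  rewrite insert₂-bump {r₂ = r₂} p q p≤x x<y
        | rowInsert-append r₂ (row₂-below-bumped fc I (∈-++⁺ʳ p (here refl)) x<y)
  = invariant-bump p q I p≤x x<y

data Row₁Shift (r₂ : List ℕ) : List ℕ → List ℕ → Set where
  same  : ∀ {r} → Row₁Shift r₂ r r
  extra : ∀ as {m} bs → m ∈ r₂ → Row₁Shift r₂ (as ++ m ∷ bs) (as ++ bs)

-- v is shifted to w when w may have moved one entry of v's first row down into its second row.
record Shifted (v w : Rows) : Set where
  constructor shifted
  field
    row₂⊆     : row₂ v ⊆ₘ row₂ w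
    row₁Shift : Row₁Shift (row₂ w) (row₁ v) (row₁ w)

Shifted-refl : ∀ {rs} → Shifted rs rs
Shifted-refl = shifted Subset.⊆-refl same

Row₁Shift-last : ∀ {m r₂} r → m ∈ r₂ → Row₁Shift r₂ (r ∷ʳ m) r
Row₁Shift-last r m∈r₂ = subst (Row₁Shift _ (r ∷ʳ _)) (++-identityʳ r) (extra r [] m∈r₂)

Row₁Shift-⊇ : ∀ {r₂ r r′} → Row₁Shift r₂ r r′ → r′ ⊆ₘ r
Row₁Shift-⊇ same                = Subset.⊆-refl
Row₁Shift-⊇ (extra as {m} bs _) = Subset.++⁺ʳ as (Subset.xs⊆x∷xs bs m)

data DeletedInsertion (m : ℕ) : List ℕ × Maybe ℕ → List ℕ × Maybe ℕ → Set where
  alike     : ∀ as bs b → DeletedInsertion m (as ++ m ∷ bs , b) (as ++ bs , b)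
  bumpsLast : ∀ r → DeletedInsertion m (r , just m) (r , nothing)
  bumpsNext : ∀ as s bs → DeletedInsertion m (as ++ s ∷ bs , just m) (as ++ bs , just s)

rowInsert-delete : ∀ x as {m bs} → All (m ≤_) bs →
  DeletedInsertion m (rowInsert x (as ++ m ∷ bs)) (rowInsert x (as ++ bs))
rowInsert-delete x [] {m} {bs} m≤bs with x <? m
rowInsert-delete x [] {bs = []}     m≤bs      | yes x<m = bumpsLast (x ∷ [])
rowInsert-delete x [] {bs = s ∷ bs} (m≤s ∷ _) | yes x<m
  rewrite rowInsert-bump [] bs [] (<-≤-trans x<m m≤s) = bumpsNext (x ∷ []) s bs
... | no _ with rowInsert x bs
...   | (r , b) = alike [] r b
rowInsert-delete x (a ∷ as) {m} {bs} m≤bs with x <? a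
... | yes _ = alike (x ∷ as) bs (just a)
... | no _ with rowInsert x (as ++ m ∷ bs) | rowInsert x (as ++ bs) | rowInsert-delete x as m≤bs
...   | _ | _ | alike as′ bs′ b     = alike (a ∷ as′) bs′ b
...   | _ | _ | bumpsLast r         = bumpsLast (a ∷ r)
...   | _ | _ | bumpsNext as′ s bs′ = bumpsNext (a ∷ as′) s bs′

appendBumped-mono : ∀ {r r′} b → r ⊆ₘ r′ → appendBumped b r ⊆ₘ appendBumped b r′
appendBumped-mono nothing  r⊆r′ = r⊆r′
appendBumped-mono (just y) r⊆r′ = Subset.++⁺ r⊆r′ Subset.⊆-refl

appendBumped-⊇ : ∀ {r} b → r ⊆ₘ appendBumped b r
appendBumped-⊇ nothing  = Subset.⊆-refl
appendBumped-⊇ (just y) = Subset.xs⊆xs++ys _ _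

appendOutcome-shifted : ∀ {m o o′ r₂ r₂′} → DeletedInsertion m o o′ → r₂ ⊆ₘ r₂′ → m ∈ r₂′ →
  Shifted (appendOutcome o r₂) (appendOutcome o′ r₂′)
appendOutcome-shifted (alike as bs b) r₂⊆ m∈ =
  shifted (appendBumped-mono b r₂⊆) (extra as bs (appendBumped-⊇ b m∈))
appendOutcome-shifted (bumpsLast r) r₂⊆ m∈ = shifted (∷ʳ-⊆ₘ r₂⊆ m∈) same
appendOutcome-shifted (bumpsNext as s bs) r₂⊆ m∈ =
  shifted (∷ʳ-⊆ₘ (Subset.⊆-trans r₂⊆ (Subset.xs⊆xs++ys _ _)) (∈-++⁺ˡ m∈)) (extra as bs (∈-++⁺ʳ _ (here refl)))

rowInsert-shifted : ∀ x {r₁ r₁′ r₂ r₂′} → AllPairs _≤_ r₁ → Shifted (r₁ ∣ r₂) (r₁′ ∣ r₂′) →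
  Shifted (appendOutcome (rowInsert x r₁) r₂) (appendOutcome (rowInsert x r₁′) r₂′)
rowInsert-shifted x {r₁} _ (shifted r₂⊆ same) = shifted (appendBumped-mono (proj₂ (rowInsert x r₁)) r₂⊆) same
rowInsert-shifted x sorted (shifted r₂⊆ (extra as bs m∈)) =
  appendOutcome-shifted (rowInsert-delete x as (sorted-after as sorted)) r₂⊆ m∈

Shifted-insert₂ : ∀ {x v w} → SecondRowAppends x v → SecondRowAppends x w → AllPairs _≤_ (row₁ v) →
  Shifted v w → Shifted (insert₂ x v) (insert₂ x w)
Shifted-insert₂ {x} {v} {w} fits-v fits-w sorted-v v↝w =
  subst₂ Shifted (sym (insert₂-appending x v fits-v)) (sym (insert₂-appending x w fits-w))
    (rowInsert-shifted x sorted-v v↝w)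

insert₂-swap : ∀ {a b} r₁ r₂ → All (_≤ b) r₁ → All (_≤ b) r₂ → a < b →
  Shifted (insert₂ b (insert₂ a (r₁ ∣ r₂))) (insert₂ a (insert₂ b (r₁ ∣ r₂)))
insert₂-swap {a} {b} r₁ r₂ r₁≤b r₂≤b a<b with rowInsertion a r₁
... | appends r₁≤a = subst₂ Shifted (sym ab) (sym ba) (shifted (Subset.xs⊆xs++ys r₂ _) (Row₁Shift-last _ (∈-++⁺ʳ r₂ (here refl))))
  where
  open ≡-Reasoning
  ab : insert₂ b (insert₂ a (r₁ ∣ r₂)) ≡ (r₁ ∷ʳ a ∷ʳ b ∣ r₂)
  ab = begin
    insert₂ b (insert₂ a (r₁ ∣ r₂)) ≡⟨ cong (insert₂ b) (insert₂-append r₁≤a) ⟩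
    insert₂ b (r₁ ∷ʳ a ∣ r₂)        ≡⟨ insert₂-append (All.∷ʳ⁺ r₁≤b (<⇒≤ a<b)) ⟩
    (r₁ ∷ʳ a ∷ʳ b ∣ r₂)             ∎
  ba : insert₂ a (insert₂ b (r₁ ∣ r₂)) ≡ (r₁ ∷ʳ a ∣ r₂ ∷ʳ b)
  ba = begin
    insert₂ a (insert₂ b (r₁ ∣ r₂))       ≡⟨ cong (insert₂ a) (insert₂-append r₁≤b) ⟩
    insert₂ a (r₁ ++ b ∷ [] ∣ r₂)         ≡⟨ insert₂-bump r₁ [] r₁≤a a<b ⟩
    (r₁ ∷ʳ a ∣ proj₁ (rowInsert b r₂))    ≡⟨ cong (λ o → r₁ ∷ʳ a ∣ proj₁ o) (rowInsert-append r₂ r₂≤b) ⟩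
    (r₁ ∷ʳ a ∣ r₂ ∷ʳ b)                   ∎
... | bumps p {y} q p≤a a<y = subst₂ Shifted (sym ab) (sym ba) Shifted-refl
  where
  open ≡-Reasoning
  ab : insert₂ b (insert₂ a (p ++ y ∷ q ∣ r₂)) ≡ ((p ++ a ∷ q) ∷ʳ b ∣ proj₁ (rowInsert y r₂))
  ab = begin
    insert₂ b (insert₂ a (p ++ y ∷ q ∣ r₂))    ≡⟨ cong (insert₂ b) (insert₂-bump p q p≤a a<y) ⟩
    insert₂ b (p ++ a ∷ q ∣ proj₁ (rowInsert y r₂)) ≡⟨ insert₂-append (All-replace p q r₁≤b (<⇒≤ a<b)) ⟩
    ((p ++ a ∷ q) ∷ʳ b ∣ proj₁ (rowInsert y r₂)) ∎
  ba : insert₂ a (insert₂ b (p ++ y ∷ q ∣ r₂)) ≡ ((p ++ a ∷ q) ∷ʳ b ∣ proj₁ (rowInsert y r₂))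
  ba = begin
    insert₂ a (insert₂ b (p ++ y ∷ q ∣ r₂))    ≡⟨ cong (insert₂ a) (insert₂-append r₁≤b) ⟩
    insert₂ a ((p ++ y ∷ q) ∷ʳ b ∣ r₂)         ≡⟨ cong (λ r → insert₂ a (r ∣ r₂)) (++-assoc p (y ∷ q) (b ∷ [])) ⟩
    insert₂ a (p ++ y ∷ q ∷ʳ b ∣ r₂)           ≡⟨ insert₂-bump p (q ∷ʳ b) p≤a a<y ⟩
    (p ++ a ∷ q ∷ʳ b ∣ proj₁ (rowInsert y r₂)) ≡⟨ cong (_∣ proj₁ (rowInsert y r₂)) (sym (++-assoc p (a ∷ q) (b ∷ []))) ⟩
    ((p ++ a ∷ q) ∷ʳ b ∣ proj₁ (rowInsert y r₂)) ∎

-- The ascent swapped by s_i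

countLess-∷ : ∀ p q s → countLess p (q ∷ s) ≡ countLess p (q ∷ []) + countLess p s
countLess-∷ p q s with q <? p
... | yes _ = refl
... | no _  = refl

countLess-≮ : ∀ {p q} s → ¬ q < p → countLess p (q ∷ s) ≡ countLess p s
countLess-≮ {p} {q} s q≮p with q <? p
... | yes q<p = contradiction q<p q≮p
... | no _    = refl

countLess-≤-∷ : ∀ p q s → countLess p s ≤ countLess p (q ∷ s)
countLess-≤-∷ p q s with q <? p
... | yes _ = n≤1+n _
... | no _  = ≤-refl

countLess-swap : ∀ p a b s → countLess p (b ∷ a ∷ s) ≡ countLess p (a ∷ b ∷ s)
countLess-swap p a b s = begin
  countLess p (b ∷ a ∷ s)               ≡⟨ countLess-∷ p b (a ∷ s) ⟩
  cl b + countLess p (a ∷ s)            ≡⟨ cong (cl b +_) (countLess-∷ p a s) ⟩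
  cl b + (cl a + countLess p s)         ≡⟨ x∙yz≈y∙xz (cl b) (cl a) _ ⟩
  cl a + (cl b + countLess p s)         ≡⟨ cong (cl a +_) (countLess-∷ p b s) ⟨
  cl a + countLess p (b ∷ s)            ≡⟨ countLess-∷ p a (b ∷ s) ⟨
  countLess p (a ∷ b ∷ s)               ∎
  where
  open ≡-Reasoning
  cl : ℕ → ℕ
  cl q = countLess p (q ∷ [])

countLess-swapAt : ∀ p i v → countLess p (swapAt i v) ≡ countLess p v
countLess-swapAt p zero    []          = refl
countLess-swapAt p zero    (a ∷ [])    = refl
countLess-swapAt p zero    (a ∷ b ∷ s) = countLess-swap p a b s
countLess-swapAt p (suc i) []          = refl
countLess-swapAt p (suc i) (q ∷ v) rewrite countLess-∷ p q (swapAt i v) | countLess-∷ p q v | countLess-swapAt p i v = refl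

inv-swap-≤ : ∀ {a b} s → ¬ a < b → inv (b ∷ a ∷ s) ≤ inv (a ∷ b ∷ s)
inv-swap-≤ {a} {b} s a≮b = begin
  inv (b ∷ a ∷ s)                                  ≡⟨ cong (_+ (countLess a s + inv s)) (countLess-≮ s a≮b) ⟩
  countLess b s + (countLess a s + inv s)          ≡⟨ x∙yz≈y∙xz (countLess b s) (countLess a s) (inv s) ⟩
  countLess a s + (countLess b s + inv s)          ≤⟨ +-monoˡ-≤ (countLess b s + inv s) (countLess-≤-∷ a b s) ⟩
  inv (a ∷ b ∷ s)                                  ∎
  where open ≤-Reasoning

inv-swap-ascent : ∀ a b s → inv (b ∷ a ∷ s) ≡ suc (inv (a ∷ b ∷ s)) → a < b
inv-swap-ascent a b s e =
  decidable-stable (a <? b) λ a≮b → ≤⇒≯ (inv-swap-≤ s a≮b) (≤-reflexive (sym e))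

data AscentSwap : List ℕ → List ℕ → Set where
  swap : ∀ pre {a b} suf → a < b → AscentSwap (pre ++ a ∷ b ∷ suf) (pre ++ b ∷ a ∷ suf)

AscentSwap-∷ : ∀ x {v w} → AscentSwap v w → AscentSwap (x ∷ v) (x ∷ w)
AscentSwap-∷ x (swap pre suf a<b) = swap (x ∷ pre) suf a<b

swapAt-ascent : ∀ i v → inv (swapAt i v) ≡ suc (inv v) → AscentSwap v (swapAt i v)
swapAt-ascent zero    []          ()
swapAt-ascent zero    (a ∷ [])    ()
swapAt-ascent (suc i) []          ()
swapAt-ascent zero    (a ∷ b ∷ s) e = swap [] s (inv-swap-ascent a b s e)
swapAt-ascent (suc i) (x ∷ v)     e = AscentSwap-∷ x (swapAt-ascent i v (+-cancelˡ-≡ (countLess x v) _ _ e′))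
  where
  e′ : countLess x v + inv (swapAt i v) ≡ countLess x v + suc (inv v)
  e′ = trans (cong (_+ inv (swapAt i v)) (sym (countLess-swapAt x i v))) (trans e (sym (+-suc _ _)))

insertAll-invariant : ∀ {u rs} l → FullyCommutative (u ++ l) → Invariant u rs → Invariant (u ++ l) (insertAll rs l)
insertAll-invariant {u} {rs} [] _ I = subst (λ t → Invariant t rs) (sym (++-identityʳ u)) I
insertAll-invariant {u} (x ∷ l) fc I =
  subst (λ t → Invariant t _) (++-assoc u (x ∷ []) l)
    (insertAll-invariant l fc′ (insert₂-invariant (FullyCommutative-prefix l fc′) I))
  where
  fc′ : FullyCommutative (u ∷ʳ x ++ l)
  fc′ = FullyCommutative-∷ʳ u x l fc

insertAll-shifted : ∀ {u u′ v w} suf → FullyCommutative (u ++ suf) → FullyCommutative (u′ ++ suf) →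
  Invariant u v → Invariant u′ w → Shifted v w → Shifted (insertAll v suf) (insertAll w suf)
insertAll-shifted []        _  _   _    _    v↝w = v↝w
insertAll-shifted {u} {u′} (x ∷ suf) fc fc′ I I′ v↝w =
  insertAll-shifted suf fcx fcx′ (insert₂-invariant (FullyCommutative-prefix suf fcx) I)
    (insert₂-invariant (FullyCommutative-prefix suf fcx′) I′)
    (Shifted-insert₂ (secondRowAppends (FullyCommutative-prefix suf fcx) I)
      (secondRowAppends (FullyCommutative-prefix suf fcx′) I′) (Invariant.sorted I) v↝w)
  where
  fcx : FullyCommutative (u ∷ʳ x ++ suf)
  fcx = FullyCommutative-∷ʳ u x suf fc
  fcx′ : FullyCommutative (u′ ∷ʳ x ++ suf)
  fcx′ = FullyCommutative-∷ʳ u′ x suf fc′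

prefix-below-descent : ∀ pre {a b} suf → FullyCommutative (pre ++ b ∷ a ∷ suf) → a < b → All (_≤ b) pre
prefix-below-descent pre {a} {b} suf fc a<b = All.tabulate λ {c} c∈pre → ≮⇒≥ λ b<c →
  fc (a , b , c , ++⁺ (from∈ c∈pre) (refl ∷ refl ∷ minimum suf) , b<c , a<b)

AscentSwap-shifted : ∀ {v w} → AscentSwap v w → FullyCommutative v → FullyCommutative w →
  Shifted (insertAll ([] ∣ []) v) (insertAll ([] ∣ []) w)
AscentSwap-shifted (swap pre {a} {b} suf a<b) fc-v fc-w
  rewrite foldl-++ (λ rs x → insert₂ x rs) ([] ∣ []) pre (a ∷ b ∷ suf)
        | foldl-++ (λ rs x → insert₂ x rs) ([] ∣ []) pre (b ∷ a ∷ suf)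
  = insertAll-shifted suf fc-v′ fc-w′
      (insertAll-invariant (a ∷ b ∷ []) (FullyCommutative-prefix suf fc-v′) I)
      (insertAll-invariant (b ∷ a ∷ []) (FullyCommutative-prefix suf fc-w′) I)
      (insert₂-swap (row₁ S) (row₂ S) (All-resp-⊇ row₁⊆u below) (All-resp-⊇ row₂⊆u below) a<b)
  where
  S : Rows
  S = insertAll ([] ∣ []) pre
  I : Invariant pre S
  I = insertAll-invariant pre (FullyCommutative-prefix (a ∷ b ∷ suf) fc-v) invariant-[]
  open Invariant I
  below : All (_≤ b) pre
  below = prefix-below-descent pre suf fc-w a<b
  fc-v′ : FullyCommutative ((pre ++ a ∷ b ∷ []) ++ suf)
  fc-v′ = subst FullyCommutative (sym (++-assoc pre (a ∷ b ∷ []) suf)) fc-v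
  fc-w′ : FullyCommutative ((pre ++ b ∷ a ∷ []) ++ suf)
  fc-w′ = subst FullyCommutative (sym (++-assoc pre (b ∷ a ∷ []) suf)) fc-w

theorem3p4 : (n i : ℕ) (v w : List ℕ) → IsPerm n v → IsPerm n w → FullyCommutative v → FullyCommutative w → suc i < n → w ≡ swapAt i v → inv w ≡ suc (inv v) → ((x : ℕ) → x ∈ Row1 (P w) → x ∈ Row1 (P v)) × ((x : ℕ) → x ∈ Row2 (P v) → x ∈ Row2 (P w))
theorem3p4 n i v .(swapAt i v) _ _ fc-v fc-w _ refl length-up =
  (λ _ → Row₁Shift-⊇ row₁Shift) , (λ _ → row₂⊆)
  where
  open Shifted (subst₂ Shifted (sym (rows-P v)) (sym (rows-P (swapAt i v)))
    (AscentSwap-shifted (swapAt-ascent i v length-up) fc-v fc-w))
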